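{- Every enhanced Gelfand--Zetlin pattern of rank zero is efficient.
   Context: $\lambda=(\lambda_1\ge\dots\ge\lambda_n)$ is a partition. A Gelfand--Zetlin pattern is an integer array $(a_{ij})_{0\le i\le n-1,\,1\le j\le n-i}$ with $a_{0j}=\lambda_{n+1-j}$ and $a_{i-1,j}\le a_{ij}\le a_{i-1,j+1}$. Neighbors: $a_{ij}$ with $a_{i-1,j}$, and $a_{ij}$ with $a_{i-1,j+1}$. Triangle: top-left $a_{i-1,j}$, top-right $a_{i-1,j+1}$, bottom $a_{ij}$. An enhanced pattern is a GZ pattern with some entries encircled and some neighbor pairs joined by edges such that: (1) row-$0$ entries encircled; (2) edge-joined entries equal, lower one encircled; (3) for $1\le i\le n-2$, $a_{ij},a_{i,j+1}$ both joined to $a_{i-1,j+1}$ iff both joined to $a_{i+1,j}$; (4) if $a_{0j}=a_{0,j+1}$, $a_{1j}$ is encircled and joined to both; (5) triangle top-left $a$, top-right $b>a$, bottom $a$: bottom encircled and joined to top-left; (6) triangle top-left $a$, top-right $b>a$, bottom $b$ encircled: bottom joined to top-right; (7) all-equal triangle with top entries connected by a path of edges: bottom encircled and joined to both; (8) all-equal triangle with encircled bottom: bottom joined to at least one top entry. The rank is the number of non-encircled entries. The pattern is inefficient if it contains a triangle with all three entries equal whose bottom entry is not joined by an edge to the top-right entry, and efficient otherwise. -}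

module Defs where

open import Data.Nat using (ℕ; zero; suc; _+_; _∸_; _≤_; _<_)
open import Data.Bool using (Bool; true; false; if_then_else_)
open import Data.Product using (_×_; Σ; ∃; _,_)
open import Data.Sum using (_⊎_)
open import Relation.Binary.PropositionalEquality using (_≡_)
open import Relation.Nullary using (¬_)
open import Relation.Binary.Construct.Closure.ReflexiveTransitive using (Star)

Valid : ℕ → ℕ → ℕ → Set
Valid n i j = i < n × 1 ≤ j × j ≤ n ∸ i

-- Triangles: bottom (i , j), top-left (i-1 , j), top-right (i-1 , j+1),
-- with 1 ≤ i ≤ n-1, 1 ≤ j ≤ n-i.  We write i = suc k, so top row is k.
ValidTri : ℕ → ℕ → ℕ → Set
ValidTri n k j = suc k < n × 1 ≤ j × j ≤ n ∸ suc k

IsPartition : ℕ → (ℕ → ℕ) → Set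
IsPartition n lam = ∀ k → 1 ≤ k → suc k ≤ n → lam (suc k) ≤ lam k

Pos : Set
Pos = ℕ × ℕ

data Edge (n : ℕ) (L R : ℕ → ℕ → Bool) : Pos → Pos → Set where
  edgeL : ∀ {k j} → ValidTri n k j → L (suc k) j ≡ true → Edge n L R (suc k , j) (k , j)
  edgeR : ∀ {k j} → ValidTri n k j → R (suc k) j ≡ true → Edge n L R (suc k , j) (k , suc j)

Adj : ℕ → (ℕ → ℕ → Bool) → (ℕ → ℕ → Bool) → Pos → Pos → Set
Adj n L R p q = Edge n L R p q ⊎ Edge n L R q p

Connected : ℕ → (ℕ → ℕ → Bool) → (ℕ → ℕ → Bool) → Pos → Pos → Set
Connected n L R = Star (Adj n L R)

AllEqualTri : (ℕ → ℕ → ℕ) → ℕ → ℕ → Set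
AllEqualTri a k j = a k j ≡ a k (suc j) × a (suc k) j ≡ a k j

-- Enhanced GZ pattern with top row given by λ.
--   a i j      : the entry a_{ij}
--   circ i j   : a_{ij} is encircled
--   L (suc k) j: edge joining a_{k+1,j} and a_{k,j}     (bottom to top-left)
--   R (suc k) j: edge joining a_{k+1,j} and a_{k,j+1}   (bottom to top-right)
-- Values of a, circ, L, R outside the valid index ranges are irrelevant.
record EnhancedPattern (n : ℕ) (lam : ℕ → ℕ) : Set where
  field
    a    : ℕ → ℕ → ℕ
    circ : ℕ → ℕ → Bool
    L    : ℕ → ℕ → Bool
    R    : ℕ → ℕ → Bool

  field
    top        : ∀ j → 1 ≤ j → j ≤ n → a 0 j ≡ lam (suc n ∸ j)
    interlaceL : ∀ k j → ValidTri n k j → a k j ≤ a (suc k) j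
    interlaceR : ∀ k j → ValidTri n k j → a (suc k) j ≤ a k (suc j)
    cond1 : ∀ j → Valid n 0 j → circ 0 j ≡ true
    cond2L : ∀ k j → ValidTri n k j → L (suc k) j ≡ true →
             a (suc k) j ≡ a k j × circ (suc k) j ≡ true
    cond2R : ∀ k j → ValidTri n k j → R (suc k) j ≡ true →
             a (suc k) j ≡ a k (suc j) × circ (suc k) j ≡ true
    -- (3) for 1 ≤ i ≤ n-2 (i = suc k), j and j+1 in row i
    cond3 : ∀ k j → suc k ≤ n ∸ 2 → 1 ≤ j → suc j ≤ n ∸ suc k →
            ((R (suc k) j ≡ true × L (suc k) (suc j) ≡ true) →
               (L (suc (suc k)) j ≡ true × R (suc (suc k)) j ≡ true))
            × ((L (suc (suc k)) j ≡ true × R (suc (suc k)) j ≡ true) →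
               (R (suc k) j ≡ true × L (suc k) (suc j) ≡ true))
    cond4 : ∀ j → ValidTri n 0 j → a 0 j ≡ a 0 (suc j) →
            circ 1 j ≡ true × L 1 j ≡ true × R 1 j ≡ true
    cond5 : ∀ k j → ValidTri n k j → a k j < a k (suc j) → a (suc k) j ≡ a k j →
            circ (suc k) j ≡ true × L (suc k) j ≡ true
    cond6 : ∀ k j → ValidTri n k j → a k j < a k (suc j) → a (suc k) j ≡ a k (suc j) →
            circ (suc k) j ≡ true → R (suc k) j ≡ true
    cond7 : ∀ k j → ValidTri n k j → AllEqualTri a k j →
            Connected n L R (k , j) (k , suc j) →
            circ (suc k) j ≡ true × L (suc k) j ≡ true × R (suc k) j ≡ true
    cond8 : ∀ k j → ValidTri n k j → AllEqualTri a k j → circ (suc k) j ≡ true →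
            L (suc k) j ≡ true ⊎ R (suc k) j ≡ true

sumBelow : ℕ → (ℕ → ℕ) → ℕ
sumBelow zero    f = 0
sumBelow (suc m) f = sumBelow m f + f m

notCircled : Bool → ℕ
notCircled true  = 0
notCircled false = 1

rank : ∀ {n lam} → EnhancedPattern n lam → ℕ
rank {n} P = sumBelow n (λ i → sumBelow (n ∸ i) (λ j → notCircled (EnhancedPattern.circ P i (suc j))))

Inefficient : ∀ {n lam} → EnhancedPattern n lam → Set
Inefficient {n} P = Σ ℕ λ k → Σ ℕ λ j →
  ValidTri n k j × AllEqualTri (EnhancedPattern.a P) k j × ¬ (EnhancedPattern.R P (suc k) j ≡ true)

Efficient : ∀ {n lam} → EnhancedPattern n lam → Set
Efficient P = ¬ Inefficient P

-- With no entry left unencircled, the top entries of every all-equal triangle are joined by a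
-- path of edges, so condition (7) joins its bottom to the top-right entry.  On row 0 the path
-- comes from condition (4).  Below row 0, interlacing forces the entry between the two top
-- entries in the row above to share their value.  Each top entry is the bottom of a triangle
-- having that middle entry on top, and is joined to it: by (5) or (6) (the latter needing the
-- encircled bottom) unless that triangle is all-equal, and otherwise by induction on the row
-- followed by (7).
module Submission where

open import Defs
open import Data.Nat using (ℕ; zero; suc; _∸_; _≤_; _<_; z≤n; s≤s)
open import Data.Nat.Properties using (≤-antisym; ≤-trans; ≤-reflexive; n≤1+n; m≤n⇒m<n∨m≡n; m+n≡0⇒m≡0; m+n≡0⇒n≡0)
open import Data.Bool using (true)
open import Data.Product using (_×_; _,_; proj₁; proj₂)
open import Data.Sum using (inj₁; inj₂)
open import Relation.Binary.PropositionalEquality using (_≡_; refl; sym; trans; subst)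
open import Relation.Binary.Construct.Closure.ReflexiveTransitive using (ε; _◅_)

sumBelow≡0⇒≡0 : ∀ {m} (f : ℕ → ℕ) → sumBelow m f ≡ 0 → ∀ {i} → i < m → f i ≡ 0
sumBelow≡0⇒≡0 {suc m} f sum≡0 (s≤s i≤m) with m≤n⇒m<n∨m≡n i≤m
... | inj₁ i<m  = sumBelow≡0⇒≡0 f (m+n≡0⇒m≡0 (sumBelow m f) sum≡0) i<m
... | inj₂ refl = m+n≡0⇒n≡0 (sumBelow m f) sum≡0

notCircled≡0⇒true : ∀ b → notCircled b ≡ 0 → b ≡ true
notCircled≡0⇒true true _ = refl

≤∸suc⇒<∸ : ∀ {n m j} → m < n → j ≤ n ∸ suc m → j < n ∸ m
≤∸suc⇒<∸ {suc n} {zero}  _         j≤n∸1   = s≤s j≤n∸1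
≤∸suc⇒<∸ {suc n} {suc m} (s≤s m<n) j≤n∸sm = ≤∸suc⇒<∸ m<n j≤n∸sm

module _ {n k j : ℕ} (v : ValidTri n (suc k) j) where

  private
    1+k<n : suc k < n
    1+k<n = ≤-trans (n≤1+n _) (proj₁ v)

    j<n∸k : j < n ∸ suc k
    j<n∸k = ≤∸suc⇒<∸ 1+k<n (proj₂ (proj₂ v))

  validTri-upLeft : ValidTri n k j
  validTri-upLeft = 1+k<n , proj₁ (proj₂ v) , ≤-trans (n≤1+n j) j<n∸k

  validTri-upRight : ValidTri n k (suc j)
  validTri-upRight = 1+k<n , s≤s z≤n , j<n∸k

module _ {n : ℕ} {lam : ℕ → ℕ} (P : EnhancedPattern n lam) where

  open EnhancedPattern P

  rank≡0⇒circled : rank P ≡ 0 → ∀ {i j} → Valid n i j → circ i j ≡ true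
  rank≡0⇒circled rank≡0 {i} {suc j} (i<n , _ , j<n∸i) =
    notCircled≡0⇒true _ (sumBelow≡0⇒≡0 _ (sumBelow≡0⇒≡0 _ rank≡0 i<n) j<n∸i)

  module _ (circled : ∀ {k j} → ValidTri n k j → circ (suc k) j ≡ true) where

    mutual

      allEqual⇒topsConnected : ∀ {k j} → ValidTri n k j → AllEqualTri a k j →
                               Connected n L R (k , j) (k , suc j)
      allEqual⇒topsConnected {zero} {j} v (left≡right , _) =
        let _ , joinedL , joinedR = cond4 j v left≡right
        in inj₂ (edgeL v joinedL) ◅ inj₁ (edgeR v joinedR) ◅ ε
      allEqual⇒topsConnected {suc k} {j} v (left≡right , _) =
        inj₁ (edgeR vˡ (bottom≡topRight⇒joinedRight vˡ left≡middle))
        ◅ inj₂ (edgeL vʳ (bottom≡topLeft⇒joinedLeft vʳ (trans (sym left≡right) left≡middle)))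
        ◅ ε
        where
        vˡ = validTri-upLeft v
        vʳ = validTri-upRight v

        left≡middle : a (suc k) j ≡ a k (suc j)
        left≡middle = ≤-antisym (interlaceR k j vˡ)
          (≤-trans (interlaceL k (suc j) vʳ) (≤-reflexive (sym left≡right)))

      allEqual⇒joinedBoth : ∀ {k j} → ValidTri n k j → AllEqualTri a k j →
                            L (suc k) j ≡ true × R (suc k) j ≡ true
      allEqual⇒joinedBoth {k} {j} v allEqual =
        proj₂ (cond7 k j v allEqual (allEqual⇒topsConnected v allEqual))

      bottom≡topRight⇒joinedRight : ∀ {k j} → ValidTri n k j → a (suc k) j ≡ a k (suc j) →
                                    R (suc k) j ≡ true
      bottom≡topRight⇒joinedRight {k} {j} v bottom≡right with m≤n⇒m<n∨m≡n (interlaceL k j v)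
      ... | inj₁ left<bottom =
        cond6 k j v (subst (a k j <_) bottom≡right left<bottom) bottom≡right (circled v)
      ... | inj₂ left≡bottom =
        proj₂ (allEqual⇒joinedBoth v (trans left≡bottom bottom≡right , sym left≡bottom))

      bottom≡topLeft⇒joinedLeft : ∀ {k j} → ValidTri n k j → a (suc k) j ≡ a k j →
                                  L (suc k) j ≡ true
      bottom≡topLeft⇒joinedLeft {k} {j} v bottom≡left with m≤n⇒m<n∨m≡n (interlaceR k j v)
      ... | inj₁ bottom<right =
        proj₂ (cond5 k j v (subst (_< a k (suc j)) bottom≡left bottom<right) bottom≡left)
      ... | inj₂ bottom≡right =
        proj₁ (allEqual⇒joinedBoth v (trans (sym bottom≡left) bottom≡right , bottom≡left))

proposition4p7 : (n : ℕ) (lam : ℕ → ℕ) → IsPartition n lam →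
    (P : EnhancedPattern n lam) → rank P ≡ 0 → Efficient P
proposition4p7 n lam _ P rank≡0 (k , j , v , allEqual , ¬joinedRight) =
  ¬joinedRight (proj₂ (allEqual⇒joinedBoth P (rank≡0⇒circled P rank≡0) v allEqual))
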